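{- Let $q$ be a power of a prime $p\ge5$. If $q\equiv1\pmod 6$, Class III-c is empty. If $q\not\equiv1\pmod6$, Class III-c consists of exactly one equivalence class, represented by $f_{ -3,1}=\frac{X^3-3X+1}{X(X-1)}$.
   Context: $\mathbb F_q$ is the field with $q$ elements. $\mathrm{PGL}(2,\mathbb F_q)$ is the group of rational functions $(aX+b)/(cX+d)$, $a,b,c,d\in\mathbb F_q$, $ad-bc\ne0$, under composition; $f,g\in\mathbb F_q(X)$ are equivalent if $g=\psi\circ f\circ\phi$ for some $\psi,\phi\in\mathrm{PGL}(2,\mathbb F_q)$. For $s,t\in\mathbb F_q$ with $t(1+s+t)\neq0$ let $f_{s,t}=\frac{X^3+sX+t}{X(X-1)}$ and $G_{s,t}(X)=X^4-2X^3-sX^2-2tX+t$. Class III-c is the set of rational functions in $\mathbb F_q(X)$ equivalent to some $f_{s,t}$ (with $t(1+s+t)\neq0$) for which $G_{s,t}$ is the square of an irreducible quadratic over $\mathbb F_q$. -}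

module Defs where

open import Data.Nat as ℕ using (ℕ; zero; suc; _∸_; _⊔_)
open import Data.Fin using (Fin)
open import Data.List using (List; []; _∷_; length)
open import Data.Product using (Σ; ∃; _×_; _,_)
open import Data.Sum using (_⊎_)
open import Relation.Nullary using (¬_)
open import Relation.Binary.PropositionalEquality using (_≡_)
open import Function.Bundles using (_↔_)
open import Algebra.Structures using (IsCommutativeRing)

record FiniteField (q : ℕ) : Set₁ where
  infixl 6 _+_
  infixl 7 _*_
  field
    Carrier : Set
    _+_ _*_ : Carrier → Carrier → Carrier
    -_ : Carrier → Carrier
    0# 1# : Carrier
    isCommutativeRing : IsCommutativeRing _≡_ _+_ _*_ -_ 0# 1#
    0≢1 : ¬ (0# ≡ 1#)
    inverse : ∀ x → ¬ (x ≡ 0#) → ∃ λ y → x * y ≡ 1#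
    card : Carrier ↔ Fin q

module RatFun {q : ℕ} (F : FiniteField q) where
  open FiniteField F

  _-_ : Carrier → Carrier → Carrier
  x - y = x + (- y)

  -- polynomials as coefficient lists, lowest degree first
  Poly : Set
  Poly = List Carrier

  coeff : Poly → ℕ → Carrier
  coeff [] _ = 0#
  coeff (a ∷ P) zero = a
  coeff (a ∷ P) (suc i) = coeff P i

  -- equality of polynomials (ignores trailing zero coefficients)
  _≈ₚ_ : Poly → Poly → Set
  P ≈ₚ Q = ∀ i → coeff P i ≡ coeff Q i

  _+ₚ_ : Poly → Poly → Poly
  [] +ₚ Q = Q
  (a ∷ P) +ₚ [] = a ∷ P
  (a ∷ P) +ₚ (b ∷ Q) = (a + b) ∷ (P +ₚ Q)

  scale : Carrier → Poly → Poly
  scale c [] = []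
  scale c (a ∷ P) = (c * a) ∷ scale c P

  _*ₚ_ : Poly → Poly → Poly
  [] *ₚ Q = []
  (a ∷ P) *ₚ Q = scale a Q +ₚ (0# ∷ (P *ₚ Q))

  _^ₚ_ : Poly → ℕ → Poly
  P ^ₚ zero = 1# ∷ []
  P ^ₚ suc n = P *ₚ (P ^ₚ n)

  Xₚ : Poly
  Xₚ = 0# ∷ 1# ∷ []

  -- hom P m u v = Σ_i P_i u^i v^(m-i)  (homogenised substitution)
  hom : Poly → ℕ → Poly → Poly → Poly
  hom P m u v = go P 0
    where
    go : Poly → ℕ → Poly
    go [] i = []
    go (a ∷ R) i = (scale a ((u ^ₚ i) *ₚ (v ^ₚ (m ∸ i)))) +ₚ go R (suc i)

  IsConstant : Poly → Set
  IsConstant P = ∀ i → coeff P (suc i) ≡ 0#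

  IsUnit : Poly → Set
  IsUnit P = IsConstant P × ¬ (coeff P 0 ≡ 0#)

  Irreducible : Poly → Set
  Irreducible P = ¬ IsConstant P × (∀ U V → P ≈ₚ (U *ₚ V) → IsUnit U ⊎ IsUnit V)

  IsQuadratic : Poly → Set
  IsQuadratic P = ¬ (coeff P 2 ≡ 0#) × (∀ i → coeff P (3 ℕ.+ i) ≡ 0#)

  SquareOfIrreducibleQuadratic : Poly → Set
  SquareOfIrreducibleQuadratic P = ∃ λ H → IsQuadratic H × Irreducible H × (P ≈ₚ (H *ₚ H))

  record RatFunc : Set where
    constructor _/_∣_
    field
      num : Poly
      den : Poly
      den≠0 : ¬ (∀ i → coeff den i ≡ 0#)

  Frac : Set
  Frac = Poly × Poly

  toFrac : RatFunc → Frac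
  toFrac r = RatFunc.num r , RatFunc.den r

  _≈ᶠ_ : Frac → Frac → Set
  (N₁ , D₁) ≈ᶠ (N₂ , D₂) = (N₁ *ₚ D₂) ≈ₚ (N₂ *ₚ D₁)

  -- elements of PGL(2,F): (aX+b)/(cX+d) with ad - bc ≠ 0
  record PGL2 : Set where
    constructor mob
    field
      a b c d : Carrier
      det≠0 : ¬ ((a * d) - (b * c) ≡ 0#)

  -- ψ ∘ h  =  (a N + b D) / (c N + d D)
  postcomp : PGL2 → Frac → Frac
  postcomp (mob a b c d _) (N , D) = (scale a N +ₚ scale b D) , (scale c N +ₚ scale d D)

  -- h ∘ φ  =  N((aX+b)/(cX+d)) / D((aX+b)/(cX+d)), both multiplied by (cX+d)^m
  precomp : Frac → PGL2 → Frac
  precomp (N , D) (mob a b c d _) = hom N m u v , hom D m u v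
    where
    m = length N ⊔ length D
    u = b ∷ a ∷ []
    v = d ∷ c ∷ []

  Equivalent : RatFunc → RatFunc → Set
  Equivalent g f = ∃ λ ψ → ∃ λ φ → toFrac g ≈ᶠ postcomp ψ (precomp (toFrac f) φ)

  f : Carrier → Carrier → RatFunc
  f s t = (t ∷ s ∷ 0# ∷ 1# ∷ []) / (0# ∷ (- 1#) ∷ 1# ∷ []) ∣ λ h → 0≢1 (sym' (h 2))
    where
    sym' : ∀ {x y : Carrier} → x ≡ y → y ≡ x
    sym' _≡_.refl = _≡_.refl

  G : Carrier → Carrier → Poly
  G s t = t ∷ (- (two * t)) ∷ (- s) ∷ (- two) ∷ 1# ∷ []
    where
    two = 1# + 1#

  ClassIIIc : RatFunc → Set
  ClassIIIc g = ∃ λ s → ∃ λ t →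
    ¬ (t * (1# + s + t) ≡ 0#) × SquareOfIrreducibleQuadratic (G s t) × Equivalent g (f s t)

  three : Carrier
  three = 1# + 1# + 1#

{-# OPTIONS --safe #-}
-- Since p ≥ 5, the field has characteristic ≠ 2, 3 (otherwise translation by 1 would split it
-- into orbits of size 2 or 3).  Comparing coefficients in G_{s,t} = H² then forces s = -3, t = 1
-- and H = c (X² - X + 1), so Class III-c is the class of f_{-3,1} when X² - X + 1 is irreducible
-- and empty otherwise.  A root x of X² - X + 1 is the same as a primitive cube root of unity ω = -x,
-- and such an ω exists iff q ≡ 1 (mod 6): multiplication by ω splits F_q^* into orbits of size 3,
-- and if there is no ω, then (a , b) ↦ (b , (a b)⁻¹) has order 3 and no fixed point on
-- (F_q^*)² ∖ {(1 , 1)}, so 3 divides (q - 1)² - 1 and hence not q - 1.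
module Submission where

open import Defs
open import Algebra.Bundles using (CommutativeRing)
open import Data.Empty using (⊥-elim)
open import Data.Fin.Properties using (inj⇒≟)
open import Data.Integer.Base as ℤ using (ℤ; -[1+_]; _⊖_; _◃_; sign; ∣_∣; 0ℤ; 1ℤ)
import Data.Integer.Properties as ℤ
open import Data.List.Base using (List; []; _∷_; length; filter; map; allFin; cartesianProduct; _++_; drop; applyUpTo; replicate)
open import Data.List.Membership.Propositional using (_∈_; _∉_)
open import Data.List.Membership.Propositional.Properties
  using (∈-filter⁺; ∈-filter⁻; ∈-map⁺; ∈-allFin; ∈-cartesianProduct⁺; ∈-cartesianProduct⁻)
import Data.List.Properties as List
open import Data.List.Relation.Binary.Subset.Propositional using (_⊆_)
open import Data.List.Relation.Unary.All as All using (All; []; _∷_)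
open import Data.List.Relation.Unary.Any as Any using (here; there; any?; satisfied)
open import Data.List.Relation.Unary.Unique.Propositional using (Unique; []; _∷_)
import Data.List.Relation.Unary.Unique.Propositional.Properties as Unique
open import Data.Maybe.Base using (Maybe; just; nothing)
open import Data.Nat.Base as ℕ using (ℕ; zero; suc; _<_; _≤_; z≤n; s≤s; _%_; _/_; _^_; _∸_)
open import Data.Nat.Divisibility
  using (_∣_; divides; ∣1⇒≡1; ∣-trans; n∣m*n; ∣m⇒∣m*n; ∣m+n∣m⇒∣n; _∣0; ∣m∣n⇒∣m+n; ∣-refl; m%n≡0⇒n∣m)
open import Data.Nat.DivMod using (m≡m%n+[m/n]*n; m%n<n; [m+kn]%n≡m%n; m∣n⇒o%n%m≡o%m)
open import Data.Nat.Induction using (<-wellFounded)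
open import Data.Nat.Primality using (Prime; prime?; prime[2]; ¬prime[1]; euclidsLemma; prime⇒irreducible)
import Data.Nat.Properties as ℕ
open import Data.Product.Base using (_×_; _,_; proj₁; proj₂; ∃)
open import Data.Product.Properties using (≡-dec; ,-injectiveˡ; ,-injectiveʳ)
open import Data.Sign.Base as Sign using (Sign)
open import Data.Sum.Base using (_⊎_; inj₁; inj₂)
open import Function.Base using (_∘_; _on_)
open import Function.Bundles using (Inverse)
open import Function.Properties.Inverse using (↔⇒↣)
open import Induction.WellFounded using (Acc; acc)
import Relation.Binary.Construct.On as On
open import Relation.Binary.Definitions using (DecidableEquality; tri<; tri≈; tri>)
open import Relation.Binary.PropositionalEquality as ≡ using (_≡_; _≢_; refl; sym; trans; cong; cong₂; subst; subst₂)
open import Relation.Nullary using (¬_; contradiction; yes; no; ¬?)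
open import Relation.Nullary.Decidable using (from-yes)

-- The standard-library solvers keep coefficients in the carrier, where numerals and cancellations
-- do not compute for an abstract ring; coefficients in ℤ, read through ℤ → R, do.
module IntegerCoefficientSolver {c ℓ} (R : CommutativeRing c ℓ) where
  open CommutativeRing R renaming (refl to ≈-refl; sym to ≈-sym; trans to ≈-trans; reflexive to ≈-reflexive)
  open import Algebra.Properties.Ring ring using (-0#≈0#; -‿involutive; -‿+-comm; -‿distribˡ-*; -‿distribʳ-*; xyx⁻¹≈y)
  open import Algebra.Properties.Semiring.Mult.TCOptimised semiring using (1+×; ×-homo-+; ×1-homo-*) renaming (_×_ to _·_)
  open import Algebra.Solver.Ring.AlmostCommutativeRing using (fromCommutativeRing; _-Raw-AlmostCommutative⟶_)
  open import Relation.Binary.Reasoning.Setoid setoid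

  ⟪_⟫ : ℤ → Carrier
  ⟪ ℤ.+ n ⟫ = n · 1#
  ⟪ -[1+ n ] ⟫ = - (suc n · 1#)

  signed : Sign → Carrier → Carrier
  signed Sign.+ x = x
  signed Sign.- x = - x

  signed-cong : ∀ s {x y} → x ≈ y → signed s x ≈ signed s y
  signed-cong Sign.+ x≈y = x≈y
  signed-cong Sign.- x≈y = -‿cong x≈y

  signed-* : ∀ s t x y → signed (s Sign.* t) (x * y) ≈ signed s x * signed t y
  signed-* Sign.+ Sign.+ x y = ≈-refl
  signed-* Sign.+ Sign.- x y = -‿distribʳ-* x y
  signed-* Sign.- Sign.+ x y = -‿distribˡ-* x y
  signed-* Sign.- Sign.- x y = begin
    x * y         ≈⟨ -‿involutive (x * y) ⟨
    - - (x * y)   ≈⟨ -‿cong (-‿distribʳ-* x y) ⟩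
    - (x * - y)   ≈⟨ -‿distribˡ-* x (- y) ⟩
    - x * - y     ∎

  ⟪◃⟫ : ∀ s n → ⟪ s ◃ n ⟫ ≈ signed s (n · 1#)
  ⟪◃⟫ Sign.+ zero = ≈-refl
  ⟪◃⟫ Sign.- zero = ≈-sym -0#≈0#
  ⟪◃⟫ Sign.+ (suc n) = ≈-refl
  ⟪◃⟫ Sign.- (suc n) = ≈-refl

  ⟪⟫-signed : ∀ i → ⟪ i ⟫ ≈ signed (sign i) (∣ i ∣ · 1#)
  ⟪⟫-signed i = ≈-trans (≈-reflexive (cong ⟪_⟫ (sym (ℤ.◃-inverse i)))) (⟪◃⟫ (sign i) ∣ i ∣)

  ⟪-⟫ : ∀ i → ⟪ ℤ.- i ⟫ ≈ - ⟪ i ⟫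
  ⟪-⟫ (ℤ.+ zero) = ≈-sym -0#≈0#
  ⟪-⟫ (ℤ.+ suc n) = ≈-refl
  ⟪-⟫ -[1+ n ] = ≈-sym (-‿involutive _)

  ⟪⊖⟫ : ∀ m n → ⟪ m ⊖ n ⟫ ≈ m · 1# - n · 1#
  ⟪⊖⟫ m zero = begin
    m · 1#           ≈⟨ +-identityʳ (m · 1#) ⟨
    m · 1# + 0#      ≈⟨ +-congˡ -0#≈0# ⟨
    m · 1# - 0#      ∎
  ⟪⊖⟫ zero (suc n) = ≈-sym (+-identityˡ _)
  ⟪⊖⟫ (suc m) (suc n) = begin
    ⟪ suc m ⊖ suc n ⟫                 ≡⟨ cong ⟪_⟫ (ℤ.[1+m]⊖[1+n]≡m⊖n m n) ⟩
    ⟪ m ⊖ n ⟫                         ≈⟨ ⟪⊖⟫ m n ⟩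
    m · 1# - n · 1#                   ≈⟨ xyx⁻¹≈y 1# (m · 1# - n · 1#) ⟨
    1# + (m · 1# - n · 1#) - 1#       ≈⟨ +-assoc 1# (m · 1# - n · 1#) (- 1#) ⟩
    1# + (m · 1# - n · 1# - 1#)       ≈⟨ +-congˡ (+-assoc (m · 1#) (- (n · 1#)) (- 1#)) ⟩
    1# + (m · 1# + (- (n · 1#) - 1#)) ≈⟨ +-congˡ (+-congˡ (-‿+-comm (n · 1#) 1#)) ⟩
    1# + (m · 1# - (n · 1# + 1#))     ≈⟨ +-assoc 1# (m · 1#) _ ⟨
    1# + m · 1# - (n · 1# + 1#)       ≈⟨ +-cong (≈-sym (1+× m 1#)) (-‿cong (≈-trans (+-comm (n · 1#) 1#) (≈-sym (1+× n 1#)))) ⟩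
    suc m · 1# - suc n · 1#           ∎

  ⟪+⟫ : ∀ i j → ⟪ i ℤ.+ j ⟫ ≈ ⟪ i ⟫ + ⟪ j ⟫
  ⟪+⟫ (ℤ.+ m) (ℤ.+ n) = ×-homo-+ 1# m n
  ⟪+⟫ (ℤ.+ m) -[1+ n ] = ⟪⊖⟫ m (suc n)
  ⟪+⟫ -[1+ m ] (ℤ.+ n) = ≈-trans (⟪⊖⟫ n (suc m)) (+-comm _ _)
  ⟪+⟫ -[1+ m ] -[1+ n ] = begin
    - (suc (suc (m ℕ.+ n)) · 1#)      ≡⟨ cong (λ k → - (suc k · 1#)) (ℕ.+-suc m n) ⟨
    - ((suc m ℕ.+ suc n) · 1#)        ≈⟨ -‿cong (×-homo-+ 1# (suc m) (suc n)) ⟩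
    - (suc m · 1# + suc n · 1#)       ≈⟨ -‿+-comm _ _ ⟨
    - (suc m · 1#) + - (suc n · 1#)   ∎

  ⟪*⟫ : ∀ i j → ⟪ i ℤ.* j ⟫ ≈ ⟪ i ⟫ * ⟪ j ⟫
  ⟪*⟫ i j = begin
    ⟪ s ◃ (∣ i ∣ ℕ.* ∣ j ∣) ⟫                                     ≈⟨ ⟪◃⟫ s (∣ i ∣ ℕ.* ∣ j ∣) ⟩
    signed s ((∣ i ∣ ℕ.* ∣ j ∣) · 1#)                             ≈⟨ signed-cong s (×1-homo-* ∣ i ∣ ∣ j ∣) ⟩
    signed s (∣ i ∣ · 1# * ∣ j ∣ · 1#)                            ≈⟨ signed-* (sign i) (sign j) _ _ ⟩
    signed (sign i) (∣ i ∣ · 1#) * signed (sign j) (∣ j ∣ · 1#)   ≈⟨ *-cong (⟪⟫-signed i) (⟪⟫-signed j) ⟨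
    ⟪ i ⟫ * ⟪ j ⟫                                                 ∎
    where
    s : Sign
    s = sign i Sign.* sign j

  ⟪⟫-morphism : ℤ.+-*-rawRing -Raw-AlmostCommutative⟶ fromCommutativeRing R
  ⟪⟫-morphism = record
    { ⟦_⟧ = ⟪_⟫ ; +-homo = ⟪+⟫ ; *-homo = ⟪*⟫ ; -‿homo = ⟪-⟫ ; 0-homo = ≈-refl ; 1-homo = ≈-refl }

  ⟪⟫-≟ : ∀ i j → Maybe (⟪ i ⟫ ≈ ⟪ j ⟫)
  ⟪⟫-≟ i j with i ℤ.≟ j
  ... | yes refl = just ≈-refl
  ... | no _ = nothing

  open import Algebra.Solver.Ring ℤ.+-*-rawRing (fromCommutativeRing R) ⟪⟫-morphism ⟪⟫-≟ public

prime∣m^k⇒prime∣m : ∀ {d} → Prime d → ∀ m k → d ∣ m ^ k → d ∣ m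
prime∣m^k⇒prime∣m d-prime m zero d∣1 = contradiction (subst Prime (∣1⇒≡1 d∣1) d-prime) ¬prime[1]
prime∣m^k⇒prime∣m d-prime m (suc k) d∣m^k with euclidsLemma m (m ^ k) d-prime d∣m^k
... | inj₁ d∣m = d∣m
... | inj₂ d∣m^k = prime∣m^k⇒prime∣m d-prime m k d∣m^k

prime∤prime^ : ∀ {d p} → Prime d → Prime p → d < p → ∀ k → ¬ d ∣ p ^ k
prime∤prime^ d-prime p-prime d<p k d∣p^k
  with prime⇒irreducible p-prime (prime∣m^k⇒prime∣m d-prime _ k d∣p^k)
... | inj₁ refl = ¬prime[1] d-prime
... | inj₂ refl = ℕ.<-irrefl refl d<p

odd⇒%2≡1 : ∀ n → ¬ 2 ∣ n → n % 2 ≡ 1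
odd⇒%2≡1 n 2∤n with n % 2 | m%n<n n 2 | m%n≡0⇒n∣m n 2
... | 0 | _ | 2∣n = contradiction (2∣n refl) 2∤n
... | 1 | _ | _ = refl
... | suc (suc _) | s≤s (s≤s ()) | _

3∣m⇒[1+m]%3≡1 : ∀ {m} → 3 ∣ m → suc m % 3 ≡ 1
3∣m⇒[1+m]%3≡1 (divides j refl) = [m+kn]%n≡m%n 1 j 3

%2≡1∧%3≡1⇒%6≡1 : ∀ n → n % 2 ≡ 1 → n % 3 ≡ 1 → n % 6 ≡ 1
%2≡1∧%3≡1⇒%6≡1 n n%2≡1 n%3≡1 = residue (n % 6) (m%n<n n 6)
  (trans (m∣n⇒o%n%m≡o%m 2 6 n (divides 3 refl)) n%2≡1)
  (trans (m∣n⇒o%n%m≡o%m 3 6 n (divides 2 refl)) n%3≡1)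
  where
  residue : ∀ r → r < 6 → r % 2 ≡ 1 → r % 3 ≡ 1 → r ≡ 1
  residue 1 _ _ _ = refl
  residue 0 _ () _
  residue 2 _ () _
  residue 3 _ _ ()
  residue 4 _ () _
  residue 5 _ _ ()
  residue (suc (suc (suc (suc (suc (suc _)))))) (s≤s (s≤s (s≤s (s≤s (s≤s (s≤s ())))))) _ _

[1+m]%6≡1⇒3∣m : ∀ m → suc m % 6 ≡ 1 → 3 ∣ m
[1+m]%6≡1⇒3∣m m [1+m]%6≡1 = ∣-trans (divides 2 refl) (subst (6 ∣_) (sym m≡[[1+m]/6]*6) (n∣m*n (suc m / 6)))
  where
  m≡[[1+m]/6]*6 : m ≡ (suc m / 6) ℕ.* 6
  m≡[[1+m]/6]*6 = ℕ.suc-injective (trans (m≡m%n+[m/n]*n (suc m) 6) (cong (ℕ._+ (suc m / 6) ℕ.* 6) [1+m]%6≡1))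

3∣m⇒3∤m²-1 : ∀ {m n} → 3 ∣ m → suc n ≡ m ℕ.* m → ¬ 3 ∣ n
3∣m⇒3∤m²-1 {m} {n} 3∣m 1+n≡m² 3∣n = contradiction (∣1⇒≡1 3∣1) λ ()
  where
  3∣1 : 3 ∣ 1
  3∣1 = ∣m+n∣m⇒∣n (subst (3 ∣_) (trans (sym 1+n≡m²) (ℕ.+-comm 1 n)) (∣m⇒∣m*n m 3∣m)) 3∣n

module Orbits {A : Set} (_≟_ : DecidableEquality A) where
  open ≡.≡-Reasoning

  infixl 5 _─_ _∖_

  _─_ : List A → A → List A
  xs ─ a = filter (λ x → ¬? (x ≟ a)) xs

  ∈-─⁻ : ∀ {a y} xs → y ∈ xs ─ a → y ∈ xs × y ≢ a
  ∈-─⁻ xs = ∈-filter⁻ (λ x → ¬? (x ≟ _)) {xs = xs}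

  ∈-─⁺ : ∀ {a y xs} → y ∈ xs → y ≢ a → y ∈ xs ─ a
  ∈-─⁺ = ∈-filter⁺ (λ x → ¬? (x ≟ _))

  ─-unique : ∀ {a xs} → Unique xs → Unique (xs ─ a)
  ─-unique = Unique.filter⁺ (λ x → ¬? (x ≟ _))

  length-─ : ∀ {a xs} → Unique xs → a ∈ xs → length xs ≡ suc (length (xs ─ a))
  length-─ {a} {x ∷ xs} (x∉xs ∷ _) (here refl) = cong (λ ys → suc (length ys)) (sym (begin
    (x ∷ xs) ─ x ≡⟨ List.filter-reject (λ y → ¬? (y ≟ x)) (λ x≢x → x≢x refl) ⟩
    xs ─ x       ≡⟨ List.filter-all (λ y → ¬? (y ≟ x)) (All.map (λ x≢y y≡x → x≢y (sym y≡x)) x∉xs) ⟩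
    xs           ∎))
  length-─ {a} {x ∷ xs} (x∉xs ∷ u) (there a∈xs) = begin
    suc (length xs)              ≡⟨ cong suc (length-─ u a∈xs) ⟩
    suc (suc (length (xs ─ a)))  ≡⟨ cong (λ ys → suc (length ys)) (List.filter-accept (λ y → ¬? (y ≟ a)) (All.lookup x∉xs a∈xs)) ⟨
    suc (length ((x ∷ xs) ─ a))  ∎

  _∖_ : List A → List A → List A
  xs ∖ [] = xs
  xs ∖ (o ∷ os) = (xs ─ o) ∖ os

  ∈-∖⁻ : ∀ {y} xs os → y ∈ xs ∖ os → y ∈ xs × y ∉ os
  ∈-∖⁻ xs [] y∈ = y∈ , λ ()
  ∈-∖⁻ xs (o ∷ os) y∈ with ∈-∖⁻ (xs ─ o) os y∈
  ... | y∈xs─o , y∉os with ∈-─⁻ xs y∈xs─o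
  ...   | y∈xs , y≢o = y∈xs , λ { (here y≡o) → y≢o y≡o ; (there y∈os) → y∉os y∈os }

  ∈-∖⁺ : ∀ {y xs} os → y ∈ xs → y ∉ os → y ∈ xs ∖ os
  ∈-∖⁺ [] y∈xs _ = y∈xs
  ∈-∖⁺ (o ∷ os) y∈xs y∉o∷os = ∈-∖⁺ os (∈-─⁺ y∈xs (λ y≡o → y∉o∷os (here y≡o))) (λ y∈os → y∉o∷os (there y∈os))

  ∖-unique : ∀ {xs} os → Unique xs → Unique (xs ∖ os)
  ∖-unique [] u = u
  ∖-unique (o ∷ os) u = ∖-unique os (─-unique u)

  length-∖ : ∀ {xs os} → Unique xs → Unique os → os ⊆ xs → length xs ≡ length os ℕ.+ length (xs ∖ os)
  length-∖ {os = []} _ _ _ = refl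
  length-∖ {xs} {o ∷ os} u (o∉os ∷ uos) o∷os⊆xs = trans (length-─ u (o∷os⊆xs (here refl)))
    (cong suc (length-∖ (─-unique u) uos os⊆xs─o))
    where
    os⊆xs─o : os ⊆ xs ─ o
    os⊆xs─o y∈os = ∈-─⁺ (o∷os⊆xs (there y∈os)) (λ y≡o → All.lookup o∉os y∈os (sym y≡o))

  record OrbitPartition (r : ℕ) (orbit : A → List A) (L : List A) : Set where
    field
      orbit-unique : ∀ {x} → x ∈ L → Unique (orbit x)
      orbit-length : ∀ {x} → x ∈ L → length (orbit x) ≡ r
      orbit-self : ∀ {x} → x ∈ L → x ∈ orbit x
      orbit-sym : ∀ {x y} → x ∈ L → y ∈ orbit x → x ∈ orbit y
      orbit-trans : ∀ {x y z} → x ∈ L → y ∈ orbit x → z ∈ orbit y → z ∈ orbit x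
      orbit-⊆ : ∀ {x} → x ∈ L → orbit x ⊆ L

  restrict : ∀ {r orbit L L′} → OrbitPartition r orbit L → L′ ⊆ L → (∀ {x y} → x ∈ L′ → y ∈ orbit x → y ∈ L′) → OrbitPartition r orbit L′
  restrict P L′⊆L closed = record
    { orbit-unique = λ x∈ → orbit-unique (L′⊆L x∈)
    ; orbit-length = λ x∈ → orbit-length (L′⊆L x∈)
    ; orbit-self = λ x∈ → orbit-self (L′⊆L x∈)
    ; orbit-sym = λ x∈ → orbit-sym (L′⊆L x∈)
    ; orbit-trans = λ x∈ → orbit-trans (L′⊆L x∈)
    ; orbit-⊆ = λ x∈ → closed x∈
    }
    where open OrbitPartition P

  orbitPartition⇒∣length : ∀ {r orbit} L → Unique L → OrbitPartition r orbit L → r ∣ length L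
  orbitPartition⇒∣length L = go L (On.wellFounded length <-wellFounded L)
    where
    go : ∀ {r orbit} L → Acc (_<_ on length) L → Unique L → OrbitPartition r orbit L → r ∣ length L
    go [] _ _ _ = _ ∣0
    go {r} {orbit} L@(x ∷ _) (acc rec) u P =
      subst (r ∣_) (sym |L|≡r+|L′|) (∣m∣n⇒∣m+n ∣-refl (go L′ (rec |L′|<|L|) (∖-unique O u) P′))
      where
      open OrbitPartition P
      O L′ : List A
      O = orbit x
      L′ = L ∖ O
      x∈L : x ∈ L
      x∈L = here refl
      |L|≡|O|+|L′| : length L ≡ length O ℕ.+ length L′
      |L|≡|O|+|L′| = length-∖ u (orbit-unique x∈L) (orbit-⊆ x∈L)
      |L|≡r+|L′| : length L ≡ r ℕ.+ length L′
      |L|≡r+|L′| = trans |L|≡|O|+|L′| (cong (ℕ._+ length L′) (orbit-length x∈L))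
      |L′|<|L| : length L′ < length L
      |L′|<|L| = ℕ.≤-trans (ℕ.+-monoˡ-≤ (length L′) (nonempty (orbit-self x∈L))) (ℕ.≤-reflexive (sym |L|≡|O|+|L′|))
        where
        nonempty : ∀ {ys} → x ∈ ys → 1 ≤ length ys
        nonempty (here _) = s≤s z≤n
        nonempty (there _) = s≤s z≤n
      P′ : OrbitPartition r orbit L′
      P′ = restrict P (λ y∈ → proj₁ (∈-∖⁻ L O y∈)) λ {y} {z} y∈L′ z∈Oy →
        let y∈L , y∉O = ∈-∖⁻ L O y∈L′
        in ∈-∖⁺ O (orbit-⊆ y∈L z∈Oy) (λ z∈O → y∉O (orbit-trans x∈L z∈O (orbit-sym y∈L z∈Oy)))

  module _ (σ : A → A) {L : List A} (closed : ∀ {x} → x ∈ L → σ x ∈ L) (no-fixed-point : ∀ {x} → x ∈ L → σ x ≢ x) where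

    involution⇒2∣length : (∀ {x} → x ∈ L → σ (σ x) ≡ x) → Unique L → 2 ∣ length L
    involution⇒2∣length σ²≡id u = orbitPartition⇒∣length L u (record
      { orbit-unique = λ x∈ → ((λ x≡σx → no-fixed-point x∈ (sym x≡σx)) ∷ []) ∷ [] ∷ []
      ; orbit-length = λ _ → refl
      ; orbit-self = λ _ → here refl
      ; orbit-sym = λ { x∈ (here refl) → here refl ; x∈ (there (here refl)) → there (here (sym (σ²≡id x∈))) }
      ; orbit-trans = λ { x∈ (here refl) z∈ → z∈
                        ; x∈ (there (here refl)) (here refl) → there (here refl)
                        ; x∈ (there (here refl)) (there (here refl)) → here (σ²≡id x∈) }
      ; orbit-⊆ = λ { x∈ (here refl) → x∈ ; x∈ (there (here refl)) → closed x∈ }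
      })
      where
      orbit : A → List A
      orbit x = x ∷ σ x ∷ []

    order3⇒3∣length : (∀ {x} → x ∈ L → σ (σ (σ x)) ≡ x) → Unique L → 3 ∣ length L
    order3⇒3∣length σ³≡id u = orbitPartition⇒∣length L u (record
      { orbit-unique = λ x∈ → ((λ x≡σx → no-fixed-point x∈ (sym x≡σx)) ∷ (λ x≡σ²x → no-fixed-point x∈ (trans (cong σ x≡σ²x) (σ³≡id x∈))) ∷ [])
                             ∷ ((λ σx≡σ²x → no-fixed-point (closed x∈) (sym σx≡σ²x)) ∷ []) ∷ [] ∷ []
      ; orbit-length = λ _ → refl
      ; orbit-self = λ _ → here refl
      ; orbit-sym = λ { x∈ (here refl) → here refl
                      ; x∈ (there (here refl)) → there (there (here (sym (σ³≡id x∈))))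
                      ; x∈ (there (there (here refl))) → there (here (sym (σ³≡id x∈))) }
      ; orbit-trans = λ { x∈ (here refl) z∈ → z∈
                        ; x∈ (there (here refl)) (here refl) → there (here refl)
                        ; x∈ (there (here refl)) (there (here refl)) → there (there (here refl))
                        ; x∈ (there (here refl)) (there (there (here refl))) → here (σ³≡id x∈)
                        ; x∈ (there (there (here refl))) (here refl) → there (there (here refl))
                        ; x∈ (there (there (here refl))) (there (here refl)) → here (σ³≡id x∈)
                        ; x∈ (there (there (here refl))) (there (there (here refl))) → there (here (cong σ (σ³≡id x∈))) }
      ; orbit-⊆ = λ { x∈ (here refl) → x∈ ; x∈ (there (here refl)) → closed x∈ ; x∈ (there (there (here refl))) → closed (closed x∈) }
      })
      where
      orbit : A → List A
      orbit x = x ∷ σ x ∷ σ (σ x) ∷ []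

length-cartesianProduct : ∀ {A B : Set} (xs : List A) (ys : List B) → length (cartesianProduct xs ys) ≡ length xs ℕ.* length ys
length-cartesianProduct [] ys = refl
length-cartesianProduct (x ∷ xs) ys = trans (List.length-++ (map (x ,_) ys))
  (cong₂ ℕ._+_ (List.length-map (x ,_) ys) (length-cartesianProduct xs ys))

module FiniteFieldProperties {q : ℕ} (F : FiniteField q) where
  open FiniteField F
  open RatFun F using (three)
  open ≡.≡-Reasoning

  ring : CommutativeRing _ _
  ring = record { isCommutativeRing = isCommutativeRing }

  module R = CommutativeRing ring
  open R using (_-_)
  open import Algebra.Properties.Ring R.ring using (+-identityʳ-unique) renaming (x∙y⁻¹≈ε⇒x≈y to x-y≡0⇒x≡y)
  open IntegerCoefficientSolver ring public using (solve; _:=_; _:+_; _:-_; _:*_; :-_; con)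

  _≟_ : DecidableEquality Carrier
  _≟_ = inj⇒≟ (↔⇒↣ card)

  open Orbits _≟_

  elements : List Carrier
  elements = map (Inverse.from card) (allFin q)

  ∈-elements : ∀ x → x ∈ elements
  ∈-elements x = subst (_∈ elements) (Inverse.strictlyInverseʳ card x)
    (∈-map⁺ (Inverse.from card) (∈-allFin (Inverse.to card x)))

  elements-unique : Unique elements
  elements-unique = Unique.map⁺ from-injective (Unique.allFin⁺ q)
    where
    from-injective : ∀ {i j} → Inverse.from card i ≡ Inverse.from card j → i ≡ j
    from-injective {i} {j} eq = begin
      i                                   ≡⟨ Inverse.strictlyInverseˡ card i ⟨
      Inverse.to card (Inverse.from card i) ≡⟨ cong (Inverse.to card) eq ⟩
      Inverse.to card (Inverse.from card j) ≡⟨ Inverse.strictlyInverseˡ card j ⟩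
      j                                   ∎

  length-elements : length elements ≡ q
  length-elements = trans (List.length-map (Inverse.from card) (allFin q)) (List.length-tabulate (λ i → i))

  1≢0 : 1# ≢ 0#
  1≢0 1≡0 = 0≢1 (sym 1≡0)

  zero-product : ∀ {x y} → x * y ≡ 0# → x ≡ 0# ⊎ y ≡ 0#
  zero-product {x} {y} xy≡0 with x ≟ 0#
  ... | yes x≡0 = inj₁ x≡0
  ... | no x≢0 = let (x′ , xx′≡1) = inverse x x≢0 in inj₂ (begin
    y               ≡⟨ R.*-identityˡ y ⟨
    1# * y          ≡⟨ cong (_* y) xx′≡1 ⟨
    x * x′ * y      ≡⟨ solve 3 (λ x x′ y → x :* x′ :* y := x′ :* (x :* y)) refl x x′ y ⟩
    x′ * (x * y)    ≡⟨ cong (x′ *_) xy≡0 ⟩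
    x′ * 0#         ≡⟨ R.zeroʳ x′ ⟩
    0#              ∎)

  *-≢0 : ∀ {x y} → x ≢ 0# → y ≢ 0# → x * y ≢ 0#
  *-≢0 x≢0 y≢0 xy≡0 with zero-product xy≡0
  ... | inj₁ x≡0 = x≢0 x≡0
  ... | inj₂ y≡0 = y≢0 y≡0

  *-cancelˡ : ∀ {a x y} → a ≢ 0# → a * x ≡ a * y → x ≡ y
  *-cancelˡ {a} {x} {y} a≢0 ax≡ay with zero-product a[x-y]≡0
    where
    a[x-y]≡0 : a * (x - y) ≡ 0#
    a[x-y]≡0 = begin
      a * (x - y)      ≡⟨ solve 3 (λ a x y → a :* (x :- y) := a :* x :- a :* y) refl a x y ⟩
      a * x - a * y    ≡⟨ cong (_- a * y) ax≡ay ⟩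
      a * y - a * y    ≡⟨ R.-‿inverseʳ (a * y) ⟩
      0#               ∎
  ... | inj₁ a≡0 = contradiction a≡0 a≢0
  ... | inj₂ x-y≡0 = x-y≡0⇒x≡y x y x-y≡0

  -- 0# ⁻¹ is the junk value 0#.
  _⁻¹ : Carrier → Carrier
  x ⁻¹ with x ≟ 0#
  ... | yes _ = 0#
  ... | no x≢0 = proj₁ (inverse x x≢0)

  x*x⁻¹≡1 : ∀ {x} → x ≢ 0# → x * x ⁻¹ ≡ 1#
  x*x⁻¹≡1 {x} x≢0 with x ≟ 0#
  ... | yes x≡0 = contradiction x≡0 x≢0
  ... | no x≢0 = proj₂ (inverse x x≢0)

  ⁻¹-unique : ∀ {x y} → x * y ≡ 1# → x ⁻¹ ≡ y
  ⁻¹-unique {x} {y} xy≡1 = *-cancelˡ x≢0 (trans (x*x⁻¹≡1 x≢0) (sym xy≡1))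
    where
    x≢0 : x ≢ 0#
    x≢0 x≡0 = 1≢0 (trans (sym xy≡1) (trans (cong (_* y) x≡0) (R.zeroˡ y)))

  ⁻¹-≢0 : ∀ {x} → x ≢ 0# → x ⁻¹ ≢ 0#
  ⁻¹-≢0 {x} x≢0 x⁻¹≡0 = 1≢0 (trans (sym (x*x⁻¹≡1 x≢0)) (trans (cong (x *_) x⁻¹≡0) (R.zeroʳ x)))

  1+1≢0 : ¬ 2 ∣ q → 1# + 1# ≢ 0#
  1+1≢0 2∤q 1+1≡0 = 2∤q (subst (2 ∣_) length-elements
    (involution⇒2∣length (_+ 1#) (λ _ → ∈-elements _) (λ _ x+1≡x → 1≢0 (+-identityʳ-unique _ 1# x+1≡x)) shift² elements-unique))
    where
    shift² : ∀ {x} → x ∈ elements → x + 1# + 1# ≡ x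
    shift² {x} _ = trans (R.+-assoc x 1# 1#) (trans (cong (x +_) 1+1≡0) (R.+-identityʳ x))

  three≢0 : ¬ 3 ∣ q → three ≢ 0#
  three≢0 3∤q three≡0 = 3∤q (subst (3 ∣_) length-elements
    (order3⇒3∣length (_+ 1#) (λ _ → ∈-elements _) (λ _ x+1≡x → 1≢0 (+-identityʳ-unique _ 1# x+1≡x)) shift³ elements-unique))
    where
    shift³ : ∀ {x} → x ∈ elements → x + 1# + 1# + 1# ≡ x
    shift³ {x} _ = begin
      x + 1# + 1# + 1#  ≡⟨ solve 1 (λ x → x :+ con 1ℤ :+ con 1ℤ :+ con 1ℤ := x :+ (con 1ℤ :+ con 1ℤ :+ con 1ℤ)) refl x ⟩
      x + three         ≡⟨ cong (x +_) three≡0 ⟩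
      x + 0#            ≡⟨ R.+-identityʳ x ⟩
      x                 ∎

  units : List Carrier
  units = elements ─ 0#

  ∈-units : ∀ {x} → x ≢ 0# → x ∈ units
  ∈-units x≢0 = ∈-─⁺ (∈-elements _) x≢0

  units-≢0 : ∀ {x} → x ∈ units → x ≢ 0#
  units-≢0 x∈ = proj₂ (∈-─⁻ elements x∈)

  units-unique : Unique units
  units-unique = ─-unique elements-unique

  q≡1+|units| : q ≡ suc (length units)
  q≡1+|units| = trans (sym length-elements) (length-─ elements-unique (∈-elements 0#))

  PrimitiveCubeRoot : Carrier → Set
  PrimitiveCubeRoot ω = ω * ω + ω + 1# ≡ 0#

  primitiveCubeRoot-cube : ∀ {ω} → PrimitiveCubeRoot ω → ω * ω * ω ≡ 1#
  primitiveCubeRoot-cube {ω} root = begin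
    ω * ω * ω                             ≡⟨ solve 1 (λ ω → ω :* ω :* ω := (ω :- con 1ℤ) :* (ω :* ω :+ ω :+ con 1ℤ) :+ con 1ℤ) refl ω ⟩
    (ω - 1#) * (ω * ω + ω + 1#) + 1#      ≡⟨ cong (λ z → (ω - 1#) * z + 1#) root ⟩
    (ω - 1#) * 0# + 1#                    ≡⟨ solve 1 (λ ω → (ω :- con 1ℤ) :* con 0ℤ :+ con 1ℤ := con 1ℤ) refl ω ⟩
    1#                                    ∎

  cube≡1⇒primitiveCubeRoot : ∀ {ω} → ω * ω * ω ≡ 1# → ω ≢ 1# → PrimitiveCubeRoot ω
  cube≡1⇒primitiveCubeRoot {ω} ω³≡1 ω≢1 with zero-product [ω-1][ω²+ω+1]≡0
    where
    [ω-1][ω²+ω+1]≡0 : (ω - 1#) * (ω * ω + ω + 1#) ≡ 0#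
    [ω-1][ω²+ω+1]≡0 = begin
      (ω - 1#) * (ω * ω + ω + 1#)  ≡⟨ solve 1 (λ ω → (ω :- con 1ℤ) :* (ω :* ω :+ ω :+ con 1ℤ) := ω :* ω :* ω :- con 1ℤ) refl ω ⟩
      ω * ω * ω - 1#               ≡⟨ cong (_- 1#) ω³≡1 ⟩
      1# - 1#                      ≡⟨ R.-‿inverseʳ 1# ⟩
      0#                           ∎
  ... | inj₁ ω-1≡0 = contradiction (x-y≡0⇒x≡y ω 1# ω-1≡0) ω≢1
  ... | inj₂ root = root

  primitiveCubeRoot⇒3∣|units| : three ≢ 0# → ∀ {ω} → PrimitiveCubeRoot ω → 3 ∣ length units
  primitiveCubeRoot⇒3∣|units| three≢0 {ω} root =
    order3⇒3∣length (ω *_) (λ y∈ → ∈-units (*-≢0 ω≢0 (units-≢0 y∈))) ωy≢y ω³y≡y units-unique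
    where
    ω≢0 : ω ≢ 0#
    ω≢0 ω≡0 = 1≢0 (trans (solve 0 (con 1ℤ := con 0ℤ :* con 0ℤ :+ con 0ℤ :+ con 1ℤ) refl) (subst PrimitiveCubeRoot ω≡0 root))
    ω≢1 : ω ≢ 1#
    ω≢1 ω≡1 = three≢0 (trans (solve 0 (con 1ℤ :+ con 1ℤ :+ con 1ℤ := con 1ℤ :* con 1ℤ :+ con 1ℤ :+ con 1ℤ) refl) (subst PrimitiveCubeRoot ω≡1 root))
    ω³y≡y : ∀ {y} → y ∈ units → ω * (ω * (ω * y)) ≡ y
    ω³y≡y {y} _ = begin
      ω * (ω * (ω * y))  ≡⟨ solve 2 (λ ω y → ω :* (ω :* (ω :* y)) := ω :* ω :* ω :* y) refl ω y ⟩
      ω * ω * ω * y      ≡⟨ cong (_* y) (primitiveCubeRoot-cube root) ⟩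
      1# * y             ≡⟨ R.*-identityˡ y ⟩
      y                  ∎
    ωy≢y : ∀ {y} → y ∈ units → ω * y ≢ y
    ωy≢y {y} y∈ ωy≡y = *-≢0 (ω≢1 ∘ x-y≡0⇒x≡y ω 1#) (units-≢0 y∈) (begin
      (ω - 1#) * y   ≡⟨ solve 2 (λ ω y → (ω :- con 1ℤ) :* y := ω :* y :- y) refl ω y ⟩
      ω * y - y      ≡⟨ cong (_- y) ωy≡y ⟩
      y - y          ≡⟨ R.-‿inverseʳ y ⟩
      0#             ∎)

  private module Pairs = Orbits (≡-dec _≟_ _≟_)

  unitPairs : List (Carrier × Carrier)
  unitPairs = cartesianProduct units units Pairs.─ (1# , 1#)

  unitPairs-unique : Unique unitPairs
  unitPairs-unique = Pairs.─-unique (Unique.cartesianProduct⁺ units-unique units-unique)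

  1+|unitPairs|≡|units|² : suc (length unitPairs) ≡ length units ℕ.* length units
  1+|unitPairs|≡|units|² = begin
    suc (length unitPairs)                       ≡⟨ Pairs.length-─ (Unique.cartesianProduct⁺ units-unique units-unique)
                                                                   (∈-cartesianProduct⁺ (∈-units 1≢0) (∈-units 1≢0)) ⟨
    length (cartesianProduct units units)        ≡⟨ length-cartesianProduct units units ⟩
    length units ℕ.* length units                ∎

  ∈-unitPairs⁺ : ∀ {a b} → a ≢ 0# → b ≢ 0# → (a , b) ≢ (1# , 1#) → (a , b) ∈ unitPairs
  ∈-unitPairs⁺ a≢0 b≢0 ab≢11 = Pairs.∈-─⁺ (∈-cartesianProduct⁺ (∈-units a≢0) (∈-units b≢0)) ab≢11

  ∈-unitPairs⁻ : ∀ {a b} → (a , b) ∈ unitPairs → a ≢ 0# × b ≢ 0# × (a , b) ≢ (1# , 1#)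
  ∈-unitPairs⁻ ab∈ with Pairs.∈-─⁻ (cartesianProduct units units) ab∈
  ... | ab∈units² , ab≢11 with ∈-cartesianProduct⁻ units units ab∈units²
  ...   | a∈ , b∈ = units-≢0 a∈ , units-≢0 b∈ , ab≢11

  xyz≡1⇒yzx≡1 : ∀ {x y z} → x * y * z ≡ 1# → y * z * x ≡ 1#
  xyz≡1⇒yzx≡1 {x} {y} {z} xyz≡1 = trans (solve 3 (λ x y z → y :* z :* x := x :* y :* z) refl x y z) xyz≡1

  -- A unit pair (a , b) stands for the triple (a , b , (a b)⁻¹) with product 1, and rotate cycles it.
  rotate : Carrier × Carrier → Carrier × Carrier
  rotate (a , b) = b , (a * b) ⁻¹

  ab[ab]⁻¹≡1 : ∀ {a b} → (a , b) ∈ unitPairs → a * b * (a * b) ⁻¹ ≡ 1#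
  ab[ab]⁻¹≡1 ab∈ = let a≢0 , b≢0 , _ = ∈-unitPairs⁻ ab∈ in x*x⁻¹≡1 (*-≢0 a≢0 b≢0)

  rotate-closed : ∀ {x} → x ∈ unitPairs → rotate x ∈ unitPairs
  rotate-closed {a , b} ab∈ = ∈-unitPairs⁺ b≢0 (⁻¹-≢0 (*-≢0 a≢0 b≢0)) rotate≢11
    where
    a≢0 : a ≢ 0#
    a≢0 = proj₁ (∈-unitPairs⁻ ab∈)
    b≢0 : b ≢ 0#
    b≢0 = proj₁ (proj₂ (∈-unitPairs⁻ ab∈))
    rotate≢11 : rotate (a , b) ≢ (1# , 1#)
    rotate≢11 rotate≡11 = proj₂ (proj₂ (∈-unitPairs⁻ ab∈)) (cong₂ _,_ a≡1 b≡1)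
      where
      b≡1 : b ≡ 1#
      b≡1 = ,-injectiveˡ rotate≡11
      a≡1 : a ≡ 1#
      a≡1 = begin
        a                   ≡⟨ solve 1 (λ a → a := a :* con 1ℤ :* con 1ℤ) refl a ⟩
        a * 1# * 1#         ≡⟨ cong₂ (λ u v → a * u * v) b≡1 (,-injectiveʳ rotate≡11) ⟨
        a * b * (a * b) ⁻¹  ≡⟨ ab[ab]⁻¹≡1 ab∈ ⟩
        1#                  ∎

  rotate³≡id : ∀ {x} → x ∈ unitPairs → rotate (rotate (rotate x)) ≡ x
  rotate³≡id {a , b} ab∈ = cong₂ _,_ [bc]⁻¹≡a (trans (cong (λ z → (c * z) ⁻¹) [bc]⁻¹≡a) [ca]⁻¹≡b)
    where
    c : Carrier
    c = (a * b) ⁻¹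
    [bc]⁻¹≡a : (b * c) ⁻¹ ≡ a
    [bc]⁻¹≡a = ⁻¹-unique (xyz≡1⇒yzx≡1 (ab[ab]⁻¹≡1 ab∈))
    [ca]⁻¹≡b : (c * a) ⁻¹ ≡ b
    [ca]⁻¹≡b = ⁻¹-unique (xyz≡1⇒yzx≡1 (xyz≡1⇒yzx≡1 (ab[ab]⁻¹≡1 ab∈)))

  rotate-fixed-point⇒primitiveCubeRoot : ∀ {x} → x ∈ unitPairs → rotate x ≡ x → PrimitiveCubeRoot (proj₁ x)
  rotate-fixed-point⇒primitiveCubeRoot {a , b} ab∈ rotate≡ab with ,-injectiveˡ rotate≡ab
  ... | refl = cube≡1⇒primitiveCubeRoot a³≡1 a≢1
    where
    a³≡1 : a * a * a ≡ 1#
    a³≡1 = trans (cong (a * a *_) (sym (,-injectiveʳ rotate≡ab))) (ab[ab]⁻¹≡1 ab∈)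
    a≢1 : a ≢ 1#
    a≢1 a≡1 = proj₂ (proj₂ (∈-unitPairs⁻ ab∈)) (cong₂ _,_ a≡1 a≡1)

  no-primitiveCubeRoot⇒3∤|units| : (∀ ω → ¬ PrimitiveCubeRoot ω) → ¬ 3 ∣ length units
  no-primitiveCubeRoot⇒3∤|units| no-root 3∣|units| = 3∣m⇒3∤m²-1 3∣|units| 1+|unitPairs|≡|units|²
    (Pairs.order3⇒3∣length rotate rotate-closed (λ x∈ → no-root _ ∘ rotate-fixed-point⇒primitiveCubeRoot x∈)
                            rotate³≡id unitPairs-unique)

  primitiveCubeRoot-exists : q % 6 ≡ 1 → ∃ PrimitiveCubeRoot
  primitiveCubeRoot-exists q%6≡1 with any? (λ ω → (ω * ω + ω + 1#) ≟ 0#) elements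
  ... | yes root∈ = satisfied root∈
  ... | no no-root∈ = contradiction 3∣|units| (no-primitiveCubeRoot⇒3∤|units| no-root)
    where
    no-root : ∀ ω → ¬ PrimitiveCubeRoot ω
    no-root ω root = no-root∈ (Any.map (λ { refl → root }) (∈-elements ω))
    3∣|units| : 3 ∣ length units
    3∣|units| = [1+m]%6≡1⇒3∣m (length units) (subst (λ n → n % 6 ≡ 1) q≡1+|units| q%6≡1)

  primitiveCubeRoot⇒q%6≡1 : ¬ 2 ∣ q → ¬ 3 ∣ q → ∀ {ω} → PrimitiveCubeRoot ω → q % 6 ≡ 1
  primitiveCubeRoot⇒q%6≡1 2∤q 3∤q root = %2≡1∧%3≡1⇒%6≡1 q (odd⇒%2≡1 q 2∤q)
    (subst (λ n → n % 3 ≡ 1) (sym q≡1+|units|) (3∣m⇒[1+m]%3≡1 (primitiveCubeRoot⇒3∣|units| (three≢0 3∤q) root)))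

module Polynomials {q : ℕ} (F : FiniteField q) where
  open FiniteField F
  open RatFun F hiding (_-_)
  open FiniteFieldProperties F
  open R using (_-_)
  open ≡.≡-Reasoning

  ∷-cong : ∀ a {P Q} → P ≈ₚ Q → (a ∷ P) ≈ₚ (a ∷ Q)
  ∷-cong a P≈Q zero = refl
  ∷-cong a P≈Q (suc i) = P≈Q i

  coeff-+ₚ : ∀ P Q i → coeff (P +ₚ Q) i ≡ coeff P i + coeff Q i
  coeff-+ₚ [] Q i = sym (R.+-identityˡ _)
  coeff-+ₚ (a ∷ P) [] i = sym (R.+-identityʳ _)
  coeff-+ₚ (a ∷ P) (b ∷ Q) zero = refl
  coeff-+ₚ (a ∷ P) (b ∷ Q) (suc i) = coeff-+ₚ P Q i

  coeff-scale : ∀ c P i → coeff (scale c P) i ≡ c * coeff P i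
  coeff-scale c [] i = sym (R.zeroʳ c)
  coeff-scale c (a ∷ P) zero = refl
  coeff-scale c (a ∷ P) (suc i) = coeff-scale c P i

  coeff-drop1 : ∀ P i → coeff (drop 1 P) i ≡ coeff P (suc i)
  coeff-drop1 [] i = refl
  coeff-drop1 (a ∷ P) i = refl

  coeff-∷-*ₚ : ∀ a P Q i → coeff ((a ∷ P) *ₚ Q) i ≡ a * coeff Q i + coeff (0# ∷ (P *ₚ Q)) i
  coeff-∷-*ₚ a P Q i = trans (coeff-+ₚ (scale a Q) (0# ∷ (P *ₚ Q)) i) (cong (_+ _) (coeff-scale a Q i))

  coeff-*ₚ-0 : ∀ P Q → coeff (P *ₚ Q) 0 ≡ coeff P 0 * coeff Q 0
  coeff-*ₚ-0 [] Q = sym (R.zeroˡ _)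
  coeff-*ₚ-0 (a ∷ P) Q = trans (coeff-∷-*ₚ a P Q 0) (R.+-identityʳ _)

  coeff-*ₚ-suc : ∀ P Q i → coeff (P *ₚ Q) (suc i) ≡ coeff P 0 * coeff Q (suc i) + coeff (drop 1 P *ₚ Q) i
  coeff-*ₚ-suc [] Q i = solve 1 (λ x → con 0ℤ := con 0ℤ :* x :+ con 0ℤ) refl (coeff Q (suc i))
  coeff-*ₚ-suc (a ∷ P) Q i = coeff-∷-*ₚ a P Q (suc i)

  +ₚ-cong : ∀ {P P′ Q Q′} → P ≈ₚ P′ → Q ≈ₚ Q′ → (P +ₚ Q) ≈ₚ (P′ +ₚ Q′)
  +ₚ-cong {P} {P′} {Q} {Q′} P≈P′ Q≈Q′ i = begin
    coeff (P +ₚ Q) i          ≡⟨ coeff-+ₚ P Q i ⟩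
    coeff P i + coeff Q i     ≡⟨ cong₂ _+_ (P≈P′ i) (Q≈Q′ i) ⟩
    coeff P′ i + coeff Q′ i   ≡⟨ coeff-+ₚ P′ Q′ i ⟨
    coeff (P′ +ₚ Q′) i        ∎

  scale-cong : ∀ c {P P′} → P ≈ₚ P′ → scale c P ≈ₚ scale c P′
  scale-cong c {P} {P′} P≈P′ i = trans (coeff-scale c P i) (trans (cong (c *_) (P≈P′ i)) (sym (coeff-scale c P′ i)))

  *ₚ-cong : ∀ {P P′ Q Q′} → P ≈ₚ P′ → Q ≈ₚ Q′ → (P *ₚ Q) ≈ₚ (P′ *ₚ Q′)
  *ₚ-cong {P} {P′} {Q} {Q′} P≈P′ Q≈Q′ zero = begin
    coeff (P *ₚ Q) 0          ≡⟨ coeff-*ₚ-0 P Q ⟩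
    coeff P 0 * coeff Q 0     ≡⟨ cong₂ _*_ (P≈P′ 0) (Q≈Q′ 0) ⟩
    coeff P′ 0 * coeff Q′ 0   ≡⟨ coeff-*ₚ-0 P′ Q′ ⟨
    coeff (P′ *ₚ Q′) 0        ∎
  *ₚ-cong {P} {P′} {Q} {Q′} P≈P′ Q≈Q′ (suc i) = begin
    coeff (P *ₚ Q) (suc i)                                          ≡⟨ coeff-*ₚ-suc P Q i ⟩
    coeff P 0 * coeff Q (suc i) + coeff (drop 1 P *ₚ Q) i           ≡⟨ cong₂ _+_ (cong₂ _*_ (P≈P′ 0) (Q≈Q′ (suc i)))
                                                                                 (*ₚ-cong {drop 1 P} {drop 1 P′} drop1≈ Q≈Q′ i) ⟩
    coeff P′ 0 * coeff Q′ (suc i) + coeff (drop 1 P′ *ₚ Q′) i       ≡⟨ coeff-*ₚ-suc P′ Q′ i ⟨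
    coeff (P′ *ₚ Q′) (suc i)                                        ∎
    where
    drop1≈ : drop 1 P ≈ₚ drop 1 P′
    drop1≈ j = trans (coeff-drop1 P j) (trans (P≈P′ (suc j)) (sym (coeff-drop1 P′ j)))

  *ₚ-zeroˡ : ∀ P Q → P ≈ₚ [] → (P *ₚ Q) ≈ₚ []
  *ₚ-zeroˡ P Q P≈0 = *ₚ-cong {P} {[]} {Q} {Q} P≈0 (λ _ → refl)

  DegreeAtMost : Poly → ℕ → Set
  DegreeAtMost P d = ∀ i → d < i → coeff P i ≡ 0#

  record HasDegree (P : Poly) (d : ℕ) : Set where
    constructor hasDegree
    field
      leading≢0 : coeff P d ≢ 0#
      degree≤ : DegreeAtMost P d

  zero-or-degree : ∀ P → P ≈ₚ [] ⊎ ∃ (HasDegree P)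
  zero-or-degree [] = inj₁ λ _ → refl
  zero-or-degree (a ∷ P) with zero-or-degree P
  ... | inj₂ (d , hasDegree lead≢0 above) = inj₂ (suc d , hasDegree lead≢0 λ { zero () ; (suc i) (s≤s d<i) → above i d<i })
  ... | inj₁ P≈0 with a ≟ 0#
  ...   | yes a≡0 = inj₁ λ { zero → a≡0 ; (suc i) → P≈0 i }
  ...   | no a≢0 = inj₂ (0 , hasDegree a≢0 λ { zero () ; (suc i) _ → P≈0 i })

  degree-unique : ∀ {P d e} → HasDegree P d → HasDegree P e → d ≡ e
  degree-unique {d = d} {e} (hasDegree lead-d above-d) (hasDegree lead-e above-e) with ℕ.<-cmp d e
  ... | tri< d<e _ _ = contradiction (above-d e d<e) lead-e
  ... | tri≈ _ d≡e _ = d≡e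
  ... | tri> _ _ e<d = contradiction (above-e d e<d) lead-d

  HasDegree-resp-≈ₚ : ∀ {P Q d} → P ≈ₚ Q → HasDegree P d → HasDegree Q d
  HasDegree-resp-≈ₚ P≈Q (hasDegree lead above) =
    hasDegree (λ lead≡0 → lead (trans (P≈Q _) lead≡0)) λ i d<i → trans (sym (P≈Q i)) (above i d<i)

  degree0⇒unit : ∀ {U} → HasDegree U 0 → IsUnit U
  degree0⇒unit (hasDegree lead above) = (λ i → above (suc i) (s≤s z≤n)) , lead

  quadratic⇒degree2 : ∀ H → IsQuadratic H → HasDegree H 2
  quadratic⇒degree2 H (lead , above) = hasDegree lead λ { (suc (suc (suc i))) _ → above i
                                                        ; zero () ; (suc zero) (s≤s ()) ; (suc (suc zero)) (s≤s (s≤s ())) }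

  *ₚ-degreeAtMost : ∀ U {V} m n → DegreeAtMost U m → DegreeAtMost V n → DegreeAtMost (U *ₚ V) (m ℕ.+ n)
  *ₚ-degreeAtMost [] m n _ _ i _ = refl
  *ₚ-degreeAtMost (a ∷ U) {V} m n U≤m V≤n zero ()
  *ₚ-degreeAtMost (a ∷ U) {V} m n U≤m V≤n (suc i) m+n<1+i = begin
    coeff ((a ∷ U) *ₚ V) (suc i)             ≡⟨ coeff-∷-*ₚ a U V (suc i) ⟩
    a * coeff V (suc i) + coeff (U *ₚ V) i   ≡⟨ cong₂ _+_ (cong (a *_) (V≤n (suc i) n<1+i)) (tail≡0 m U≤m m+n<1+i) ⟩
    a * 0# + 0#                              ≡⟨ solve 1 (λ a → a :* con 0ℤ :+ con 0ℤ := con 0ℤ) refl a ⟩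
    0#                                       ∎
    where
    n<1+i : n < suc i
    n<1+i = ℕ.≤-<-trans (ℕ.m≤n+m n m) m+n<1+i
    tail≡0 : ∀ m → DegreeAtMost (a ∷ U) m → m ℕ.+ n < suc i → coeff (U *ₚ V) i ≡ 0#
    tail≡0 zero U≤0 _ = *ₚ-zeroˡ U V (λ j → U≤0 (suc j) (s≤s z≤n)) i
    tail≡0 (suc m) U≤1+m (s≤s m+n<i) = *ₚ-degreeAtMost U m n (λ j m<j → U≤1+m (suc j) (s≤s m<j)) V≤n i m+n<i

  coeff-*ₚ-top : ∀ U {V} m n → DegreeAtMost U m → DegreeAtMost V n → coeff (U *ₚ V) (m ℕ.+ n) ≡ coeff U m * coeff V n
  coeff-*ₚ-top [] m n _ _ = sym (R.zeroˡ _)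
  coeff-*ₚ-top (a ∷ U) {V} zero n U≤0 V≤n = begin
    coeff ((a ∷ U) *ₚ V) n                    ≡⟨ coeff-∷-*ₚ a U V n ⟩
    a * coeff V n + coeff (0# ∷ (U *ₚ V)) n   ≡⟨ cong (a * coeff V n +_) (shifted≡0 n) ⟩
    a * coeff V n + 0#                        ≡⟨ R.+-identityʳ _ ⟩
    a * coeff V n                             ∎
    where
    shifted≡0 : (0# ∷ (U *ₚ V)) ≈ₚ []
    shifted≡0 zero = refl
    shifted≡0 (suc j) = *ₚ-zeroˡ U V (λ k → U≤0 (suc k) (s≤s z≤n)) j
  coeff-*ₚ-top (a ∷ U) {V} (suc m) n U≤1+m V≤n = begin
    coeff ((a ∷ U) *ₚ V) (suc (m ℕ.+ n))                     ≡⟨ coeff-∷-*ₚ a U V (suc (m ℕ.+ n)) ⟩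
    a * coeff V (suc (m ℕ.+ n)) + coeff (U *ₚ V) (m ℕ.+ n)   ≡⟨ cong₂ _+_ (cong (a *_) (V≤n _ (s≤s (ℕ.m≤n+m n m)))) (coeff-*ₚ-top U m n U≤m V≤n) ⟩
    a * 0# + coeff U m * coeff V n                           ≡⟨ solve 2 (λ a x → a :* con 0ℤ :+ x := x) refl a _ ⟩
    coeff U m * coeff V n                                    ∎
    where
    U≤m : DegreeAtMost U m
    U≤m j m<j = U≤1+m (suc j) (s≤s m<j)

  *ₚ-degree : ∀ {U V m n} → HasDegree U m → HasDegree V n → HasDegree (U *ₚ V) (m ℕ.+ n)
  *ₚ-degree {U} {V} {m} {n} (hasDegree leadU U≤m) (hasDegree leadV V≤n) =
    hasDegree (λ top≡0 → *-≢0 leadU leadV (trans (sym (coeff-*ₚ-top U m n U≤m V≤n)) top≡0)) (*ₚ-degreeAtMost U m n U≤m V≤n)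

  coeff-applyUpTo-< : ∀ (f : ℕ → Carrier) n i → i < n → coeff (applyUpTo f n) i ≡ f i
  coeff-applyUpTo-< f (suc n) zero _ = refl
  coeff-applyUpTo-< f (suc n) (suc i) (s≤s i<n) = coeff-applyUpTo-< (f ∘ suc) n i i<n

  coeff-applyUpTo-≥ : ∀ (f : ℕ → Carrier) n i → n ≤ i → coeff (applyUpTo f n) i ≡ 0#
  coeff-applyUpTo-≥ f zero i _ = refl
  coeff-applyUpTo-≥ f (suc n) (suc i) (s≤s n≤i) = coeff-applyUpTo-≥ (f ∘ suc) n i n≤i

  degreeAtMost⇒≈ₚ-applyUpTo : ∀ P {d} → DegreeAtMost P d → P ≈ₚ applyUpTo (coeff P) (suc d)
  degreeAtMost⇒≈ₚ-applyUpTo P {d} P≤d i with i ℕ.≤? d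
  ... | yes i≤d = sym (coeff-applyUpTo-< (coeff P) (suc d) i (s≤s i≤d))
  ... | no i≰d = trans (P≤d i (ℕ.≰⇒> i≰d)) (sym (coeff-applyUpTo-≥ (coeff P) (suc d) i (ℕ.≰⇒> i≰d)))

  linear-*ₚ-linear : ∀ u₀ u₁ v₀ v₁ →
    ((u₀ ∷ u₁ ∷ []) *ₚ (v₀ ∷ v₁ ∷ [])) ≈ₚ (u₀ * v₀ ∷ u₀ * v₁ + u₁ * v₀ ∷ u₁ * v₁ ∷ [])
  linear-*ₚ-linear u₀ u₁ v₀ v₁ zero = R.+-identityʳ _
  linear-*ₚ-linear u₀ u₁ v₀ v₁ (suc zero) = cong (u₀ * v₁ +_) (R.+-identityʳ _)
  linear-*ₚ-linear u₀ u₁ v₀ v₁ (suc (suc i)) = refl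

  quadratic-square : ∀ h₀ h₁ h₂ → ((h₀ ∷ h₁ ∷ h₂ ∷ []) *ₚ (h₀ ∷ h₁ ∷ h₂ ∷ [])) ≈ₚ
    (h₀ * h₀ ∷ (1# + 1#) * (h₀ * h₁) ∷ (1# + 1#) * (h₀ * h₂) + h₁ * h₁ ∷ (1# + 1#) * (h₁ * h₂) ∷ h₂ * h₂ ∷ [])
  quadratic-square h₀ h₁ h₂ zero = R.+-identityʳ _
  quadratic-square h₀ h₁ h₂ (suc zero) =
    solve 2 (λ h₀ h₁ → h₀ :* h₁ :+ (h₁ :* h₀ :+ con 0ℤ) := (con 1ℤ :+ con 1ℤ) :* (h₀ :* h₁)) refl h₀ h₁
  quadratic-square h₀ h₁ h₂ (suc (suc zero)) =
    solve 3 (λ h₀ h₁ h₂ → h₀ :* h₂ :+ (h₁ :* h₁ :+ (h₂ :* h₀ :+ con 0ℤ)) := (con 1ℤ :+ con 1ℤ) :* (h₀ :* h₂) :+ h₁ :* h₁) refl h₀ h₁ h₂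
  quadratic-square h₀ h₁ h₂ (suc (suc (suc zero))) =
    solve 2 (λ h₁ h₂ → h₁ :* h₂ :+ h₂ :* h₁ := (con 1ℤ :+ con 1ℤ) :* (h₁ :* h₂)) refl h₁ h₂
  quadratic-square h₀ h₁ h₂ (suc (suc (suc (suc i)))) = refl

module IdentityEquivalence {q : ℕ} (F : FiniteField q) where
  open FiniteField F
  open RatFun F hiding (_-_)
  open FiniteFieldProperties F
  open Polynomials F
  open ≡.≡-Reasoning

  idₘ : PGL2
  idₘ = mob 1# 0# 0# 1# λ det≡0 → 1≢0 (trans (solve 0 (con 1ℤ := con 1ℤ :* con 1ℤ :- con 0ℤ :* con 0ℤ) refl) det≡0)

  ≈ₚ⇒≈ᶠ : ∀ {N D N′ D′} → N′ ≈ₚ N → D′ ≈ₚ D → (N , D) ≈ᶠ (N′ , D′)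
  ≈ₚ⇒≈ᶠ {N} {D} {N′} {D′} N′≈N D′≈D i =
    trans (*ₚ-cong {N} {N} {D′} {D} (λ _ → refl) D′≈D i) (sym (*ₚ-cong {N′} {N} {D} {D} N′≈N (λ _ → refl) i))

  postcomp-identity : ∀ N D → proj₁ (postcomp idₘ (N , D)) ≈ₚ N × proj₂ (postcomp idₘ (N , D)) ≈ₚ D
  postcomp-identity N D = (λ i → begin
      coeff (scale 1# N +ₚ scale 0# D) i           ≡⟨ coeff-+ₚ (scale 1# N) (scale 0# D) i ⟩
      coeff (scale 1# N) i + coeff (scale 0# D) i  ≡⟨ cong₂ _+_ (coeff-scale 1# N i) (coeff-scale 0# D i) ⟩
      1# * coeff N i + 0# * coeff D i              ≡⟨ solve 2 (λ n d → con 1ℤ :* n :+ con 0ℤ :* d := n) refl (coeff N i) (coeff D i) ⟩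
      coeff N i                                    ∎)
    , (λ i → begin
      coeff (scale 0# N +ₚ scale 1# D) i           ≡⟨ coeff-+ₚ (scale 0# N) (scale 1# D) i ⟩
      coeff (scale 0# N) i + coeff (scale 1# D) i  ≡⟨ cong₂ _+_ (coeff-scale 0# N i) (coeff-scale 1# D i) ⟩
      0# * coeff N i + 1# * coeff D i              ≡⟨ solve 2 (λ n d → con 0ℤ :* n :+ con 1ℤ :* d := d) refl (coeff N i) (coeff D i) ⟩
      coeff D i                                    ∎)

  -- The summation of `hom`, which is local to its definition: `hom P m u v` and `homSum m u v P 0`
  -- agree definitionally as soon as the coefficient list P is given explicitly.
  homSum : ℕ → Poly → Poly → Poly → ℕ → Poly
  homSum m u v [] i = []
  homSum m u v (a ∷ P) i = scale a ((u ^ₚ i) *ₚ (v ^ₚ (m ∸ i))) +ₚ homSum m u v P (suc i)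

  constant-*ₚ : ∀ a Q → ((a ∷ []) *ₚ Q) ≈ₚ scale a Q
  constant-*ₚ a Q zero = trans (coeff-+ₚ (scale a Q) (0# ∷ []) 0) (R.+-identityʳ _)
  constant-*ₚ a Q (suc i) = trans (coeff-+ₚ (scale a Q) (0# ∷ []) (suc i)) (R.+-identityʳ _)

  Xₚ-*ₚ : ∀ Q → (Xₚ *ₚ Q) ≈ₚ (0# ∷ Q)
  Xₚ-*ₚ Q zero = begin
    coeff (Xₚ *ₚ Q) 0        ≡⟨ coeff-∷-*ₚ 0# (1# ∷ []) Q 0 ⟩
    0# * coeff Q 0 + 0#      ≡⟨ solve 1 (λ x → con 0ℤ :* x :+ con 0ℤ := con 0ℤ) refl (coeff Q 0) ⟩
    0#                       ∎
  Xₚ-*ₚ Q (suc i) = begin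
    coeff (Xₚ *ₚ Q) (suc i)                      ≡⟨ coeff-∷-*ₚ 0# (1# ∷ []) Q (suc i) ⟩
    0# * coeff Q (suc i) + coeff ((1# ∷ []) *ₚ Q) i ≡⟨ cong (0# * coeff Q (suc i) +_) (constant-*ₚ 1# Q i) ⟩
    0# * coeff Q (suc i) + coeff (scale 1# Q) i  ≡⟨ cong (0# * coeff Q (suc i) +_) (coeff-scale 1# Q i) ⟩
    0# * coeff Q (suc i) + 1# * coeff Q i        ≡⟨ solve 2 (λ x y → con 0ℤ :* x :+ con 1ℤ :* y := y) refl (coeff Q (suc i)) (coeff Q i) ⟩
    coeff Q i                                    ∎

  1+0X-*ₚ : ∀ Q → ((1# ∷ 0# ∷ []) *ₚ Q) ≈ₚ Q
  1+0X-*ₚ Q i = begin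
    coeff ((1# ∷ 0# ∷ []) *ₚ Q) i                          ≡⟨ coeff-∷-*ₚ 1# (0# ∷ []) Q i ⟩
    1# * coeff Q i + coeff (0# ∷ ((0# ∷ []) *ₚ Q)) i       ≡⟨ cong (1# * coeff Q i +_) (shifted≡0 i) ⟩
    1# * coeff Q i + 0#                                    ≡⟨ solve 1 (λ x → con 1ℤ :* x :+ con 0ℤ := x) refl (coeff Q i) ⟩
    coeff Q i                                              ∎
    where
    shifted≡0 : ∀ i → coeff (0# ∷ ((0# ∷ []) *ₚ Q)) i ≡ 0#
    shifted≡0 zero = refl
    shifted≡0 (suc i) = trans (constant-*ₚ 0# Q i) (trans (coeff-scale 0# Q i) (R.zeroˡ _))

  *ₚ-identityʳ : ∀ P → (P *ₚ (1# ∷ [])) ≈ₚ P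
  *ₚ-identityʳ [] i = refl
  *ₚ-identityʳ (a ∷ P) zero = solve 1 (λ a → a :* con 1ℤ :+ con 0ℤ := a) refl a
  *ₚ-identityʳ (a ∷ P) (suc i) = *ₚ-identityʳ P i

  Xₚ^ₚ : ∀ i → (Xₚ ^ₚ i) ≈ₚ (replicate i 0# ++ 1# ∷ [])
  Xₚ^ₚ zero _ = refl
  Xₚ^ₚ (suc i) j = trans (Xₚ-*ₚ (Xₚ ^ₚ i) j) (∷-cong 0# (Xₚ^ₚ i) j)

  [1+0X]^ₚ : ∀ i → ((1# ∷ 0# ∷ []) ^ₚ i) ≈ₚ (1# ∷ [])
  [1+0X]^ₚ zero _ = refl
  [1+0X]^ₚ (suc i) j = trans (1+0X-*ₚ ((1# ∷ 0# ∷ []) ^ₚ i) j) ([1+0X]^ₚ i j)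

  replicate-0# : ∀ i → (replicate i 0# ++ []) ≈ₚ []
  replicate-0# zero _ = refl
  replicate-0# (suc i) zero = refl
  replicate-0# (suc i) (suc j) = replicate-0# i j

  add-monomial : ∀ i a P → (scale a (replicate i 0# ++ 1# ∷ []) +ₚ (replicate (suc i) 0# ++ P)) ≈ₚ (replicate i 0# ++ a ∷ P)
  add-monomial zero a P zero = solve 1 (λ a → a :* con 1ℤ :+ con 0ℤ := a) refl a
  add-monomial zero a P (suc j) = refl
  add-monomial (suc i) a P zero = solve 1 (λ a → a :* con 0ℤ :+ con 0ℤ := con 0ℤ) refl a
  add-monomial (suc i) a P (suc j) = add-monomial i a P j

  homSum-identity : ∀ m P i → homSum m Xₚ (1# ∷ 0# ∷ []) P i ≈ₚ (replicate i 0# ++ P)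
  homSum-identity m [] i j = sym (replicate-0# i j)
  homSum-identity m (a ∷ P) i j = trans (+ₚ-cong {scale a monomial} {scale a (replicate i 0# ++ 1# ∷ [])}
                                                  {homSum m Xₚ (1# ∷ 0# ∷ []) P (suc i)} {replicate (suc i) 0# ++ P}
                                                  (scale-cong a {monomial} {replicate i 0# ++ 1# ∷ []} monomial≈) (homSum-identity m P (suc i)) j)
                                        (add-monomial i a P j)
    where
    monomial : Poly
    monomial = (Xₚ ^ₚ i) *ₚ ((1# ∷ 0# ∷ []) ^ₚ (m ∸ i))
    monomial≈ : monomial ≈ₚ (replicate i 0# ++ 1# ∷ [])
    monomial≈ k = trans (*ₚ-cong {Xₚ ^ₚ i} {replicate i 0# ++ 1# ∷ []} {(1# ∷ 0# ∷ []) ^ₚ (m ∸ i)} {1# ∷ []}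
                                 (Xₚ^ₚ i) ([1+0X]^ₚ (m ∸ i)) k)
                        (*ₚ-identityʳ (replicate i 0# ++ 1# ∷ []) k)

  f-equivalent-to-itself : ∀ s t → Equivalent (f s t) (f s t)
  f-equivalent-to-itself s t = idₘ , idₘ , ≈ₚ⇒≈ᶠ {N} {D} {proj₁ (postcomp idₘ (N′ , D′))} {proj₂ (postcomp idₘ (N′ , D′))}
    (λ i → trans (proj₁ (postcomp-identity N′ D′) i) (homSum-identity 4 N 0 i))
    (λ i → trans (proj₂ (postcomp-identity N′ D′) i) (homSum-identity 4 D 0 i))
    where
    N D N′ D′ : Poly
    N = RatFunc.num (f s t)
    D = RatFunc.den (f s t)
    N′ = homSum 4 Xₚ (1# ∷ 0# ∷ []) N 0
    D′ = homSum 4 Xₚ (1# ∷ 0# ∷ []) D 0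

module Classification {q : ℕ} (F : FiniteField q) where
  open FiniteField F
  open RatFun F hiding (_-_)
  open FiniteFieldProperties F
  open Polynomials F
  open IdentityEquivalence F
  open R using (_-_)
  open ≡.≡-Reasoning

  Φ₆ : Poly
  Φ₆ = 1# ∷ - 1# ∷ 1# ∷ []

  Φ₆-quadratic : IsQuadratic Φ₆
  Φ₆-quadratic = 1≢0 , λ _ → refl

  G₋₃,₁≈Φ₆² : G (- three) 1# ≈ₚ (Φ₆ *ₚ Φ₆)
  G₋₃,₁≈Φ₆² i = trans (coefficients i) (sym (quadratic-square 1# (- 1#) 1# i))
    where
    coefficients : G (- three) 1# ≈ₚ
      (1# * 1# ∷ (1# + 1#) * (1# * - 1#) ∷ (1# + 1#) * (1# * 1#) + - 1# * - 1# ∷ (1# + 1#) * (- 1# * 1#) ∷ 1# * 1# ∷ [])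
    coefficients zero = solve 0 (con 1ℤ := con 1ℤ :* con 1ℤ) refl
    coefficients (suc zero) = solve 0 (:- ((con 1ℤ :+ con 1ℤ) :* con 1ℤ) := (con 1ℤ :+ con 1ℤ) :* (con 1ℤ :* :- con 1ℤ)) refl
    coefficients (suc (suc zero)) =
      solve 0 (:- (:- (con 1ℤ :+ con 1ℤ :+ con 1ℤ)) := (con 1ℤ :+ con 1ℤ) :* (con 1ℤ :* con 1ℤ) :+ :- con 1ℤ :* :- con 1ℤ) refl
    coefficients (suc (suc (suc zero))) = solve 0 (:- (con 1ℤ :+ con 1ℤ) := (con 1ℤ :+ con 1ℤ) :* (:- con 1ℤ :* con 1ℤ)) refl
    coefficients (suc (suc (suc (suc zero)))) = solve 0 (con 1ℤ := con 1ℤ :* con 1ℤ) refl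
    coefficients (suc (suc (suc (suc (suc i))))) = refl

  -- u₀ + u₁ X vanishes at -ω, and Φ₆(-ω) = ω² + ω + 1.
  linear-factor⇒primitiveCubeRoot : ∀ {u₀ u₁ v₀ v₁} → u₁ ≢ 0# →
    Φ₆ ≈ₚ ((u₀ ∷ u₁ ∷ []) *ₚ (v₀ ∷ v₁ ∷ [])) → PrimitiveCubeRoot (u₀ * u₁ ⁻¹)
  linear-factor⇒primitiveCubeRoot {u₀} {u₁} {v₀} {v₁} u₁≢0 Φ₆≈UV = begin
    ω * ω + ω + 1#
      ≡⟨ solve 1 (λ ω → ω :* ω :+ ω :+ con 1ℤ := con 1ℤ :* (ω :* ω) :- (:- con 1ℤ) :* ω :+ con 1ℤ) refl ω ⟩
    1# * (ω * ω) - (- 1#) * ω + 1#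
      ≡⟨ cong₂ (λ a b → a * (ω * ω) - b * ω + 1#) (coefficient 2) (coefficient 1) ⟩
    u₁ * v₁ * (ω * ω) - (u₀ * v₁ + u₁ * v₀) * ω + 1#
      ≡⟨ cong (u₁ * v₁ * (ω * ω) - (u₀ * v₁ + u₁ * v₀) * ω +_) (coefficient 0) ⟩
    u₁ * v₁ * (ω * ω) - (u₀ * v₁ + u₁ * v₀) * ω + u₀ * v₀
      ≡⟨ solve 5 (λ u₀ u₁ v₀ v₁ ω → u₁ :* v₁ :* (ω :* ω) :- (u₀ :* v₁ :+ u₁ :* v₀) :* ω :+ u₀ :* v₀
                                     := (u₀ :- u₁ :* ω) :* (v₀ :- v₁ :* ω)) refl u₀ u₁ v₀ v₁ ω ⟩
    (u₀ - u₁ * ω) * (v₀ - v₁ * ω)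
      ≡⟨ cong (_* (v₀ - v₁ * ω)) u₀-u₁ω≡0 ⟩
    0# * (v₀ - v₁ * ω)
      ≡⟨ R.zeroˡ _ ⟩
    0#
      ∎
    where
    ω : Carrier
    ω = u₀ * u₁ ⁻¹
    coefficient : ∀ i → coeff Φ₆ i ≡ coeff (u₀ * v₀ ∷ u₀ * v₁ + u₁ * v₀ ∷ u₁ * v₁ ∷ []) i
    coefficient i = trans (Φ₆≈UV i) (linear-*ₚ-linear u₀ u₁ v₀ v₁ i)
    u₀-u₁ω≡0 : u₀ - u₁ * ω ≡ 0#
    u₀-u₁ω≡0 = begin
      u₀ - u₁ * (u₀ * u₁ ⁻¹)    ≡⟨ solve 3 (λ u₀ u₁ w → u₀ :- u₁ :* (u₀ :* w) := u₀ :- u₀ :* (u₁ :* w)) refl u₀ u₁ (u₁ ⁻¹) ⟩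
      u₀ - u₀ * (u₁ * u₁ ⁻¹)    ≡⟨ cong (λ z → u₀ - u₀ * z) (x*x⁻¹≡1 u₁≢0) ⟩
      u₀ - u₀ * 1#              ≡⟨ solve 1 (λ u₀ → u₀ :- u₀ :* con 1ℤ := con 0ℤ) refl u₀ ⟩
      0#                        ∎

  Φ₆-irreducible : (∀ ω → ¬ PrimitiveCubeRoot ω) → Irreducible Φ₆
  Φ₆-irreducible no-root = (λ Φ₆-constant → 1≢0 (Φ₆-constant 1)) , factors
    where
    factors : ∀ U V → Φ₆ ≈ₚ (U *ₚ V) → IsUnit U ⊎ IsUnit V
    factors U V Φ₆≈UV with zero-or-degree U | zero-or-degree V
    ... | inj₁ U≈0 | _ = ⊥-elim (1≢0 (trans (Φ₆≈UV 0) (trans (coeff-*ₚ-0 U V) (trans (cong (_* coeff V 0) (U≈0 0)) (R.zeroˡ _)))))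
    ... | inj₂ _ | inj₁ V≈0 = ⊥-elim (1≢0 (trans (Φ₆≈UV 0) (trans (coeff-*ₚ-0 U V) (trans (cong (coeff U 0 *_) (V≈0 0)) (R.zeroʳ _)))))
    ... | inj₂ (m , degU) | inj₂ (n , degV) =
      split m n (degree-unique (*ₚ-degree degU degV) (HasDegree-resp-≈ₚ Φ₆≈UV (quadratic⇒degree2 Φ₆ Φ₆-quadratic))) degU degV
      where
      split : ∀ m n → m ℕ.+ n ≡ 2 → HasDegree U m → HasDegree V n → IsUnit U ⊎ IsUnit V
      split 0 _ _ degU _ = inj₁ (degree0⇒unit degU)
      split 2 0 _ _ degV = inj₂ (degree0⇒unit degV)
      split 1 1 _ (hasDegree u₁≢0 U≤1) (hasDegree _ V≤1) = ⊥-elim (no-root _ (linear-factor⇒primitiveCubeRoot u₁≢0 Φ₆≈linear²))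
        where
        Φ₆≈linear² : Φ₆ ≈ₚ ((coeff U 0 ∷ coeff U 1 ∷ []) *ₚ (coeff V 0 ∷ coeff V 1 ∷ []))
        Φ₆≈linear² i = trans (Φ₆≈UV i) (*ₚ-cong {U} {coeff U 0 ∷ coeff U 1 ∷ []} {V} {coeff V 0 ∷ coeff V 1 ∷ []}
                                                     (degreeAtMost⇒≈ₚ-applyUpTo U U≤1) (degreeAtMost⇒≈ₚ-applyUpTo V V≤1) i)
      split 1 0 ()
      split 1 (suc (suc _)) ()
      split 2 (suc _) ()
      split (suc (suc (suc _))) _ ()

  scaled-Φ₆-reducible : ∀ {c ω H} → c ≢ 0# → PrimitiveCubeRoot ω → H ≈ₚ scale c Φ₆ → ¬ Irreducible H
  scaled-Φ₆-reducible {c} {ω} {H} c≢0 root H≈cΦ₆ (_ , irreducible) with irreducible U V H≈UV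
    where
    U V : Poly
    U = c * ω ∷ c ∷ []
    V = - (1# + ω) ∷ 1# ∷ []
    cΦ₆≈UV : ∀ i → coeff (scale c Φ₆) i ≡ coeff (c * ω * - (1# + ω) ∷ c * ω * 1# + c * - (1# + ω) ∷ c * 1# ∷ []) i
    cΦ₆≈UV zero = begin
      c * 1#
        ≡⟨ solve 2 (λ c ω → c :* con 1ℤ := c :* ω :* :- (con 1ℤ :+ ω) :+ c :* (ω :* ω :+ ω :+ con 1ℤ)) refl c ω ⟩
      c * ω * - (1# + ω) + c * (ω * ω + ω + 1#)
        ≡⟨ cong (λ z → c * ω * - (1# + ω) + c * z) root ⟩
      c * ω * - (1# + ω) + c * 0#
        ≡⟨ solve 2 (λ c ω → c :* ω :* :- (con 1ℤ :+ ω) :+ c :* con 0ℤ := c :* ω :* :- (con 1ℤ :+ ω)) refl c ω ⟩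
      c * ω * - (1# + ω)
        ∎
    cΦ₆≈UV (suc zero) = solve 2 (λ c ω → c :* :- con 1ℤ := c :* ω :* con 1ℤ :+ c :* :- (con 1ℤ :+ ω)) refl c ω
    cΦ₆≈UV (suc (suc zero)) = refl
    cΦ₆≈UV (suc (suc (suc i))) = refl
    H≈UV : H ≈ₚ (U *ₚ V)
    H≈UV i = trans (H≈cΦ₆ i) (trans (cΦ₆≈UV i) (sym (linear-*ₚ-linear (c * ω) c (- (1# + ω)) 1# i)))
  ... | inj₁ (U-constant , _) = c≢0 (U-constant 0)
  ... | inj₂ (V-constant , _) = 1≢0 (V-constant 0)

  y²≡1⇒xy≡-1⇒x≡-y : ∀ {x y} → y * y ≡ 1# → x * y ≡ - 1# → x ≡ - y
  y²≡1⇒xy≡-1⇒x≡-y {x} {y} y²≡1 xy≡-1 = begin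
    x              ≡⟨ solve 1 (λ x → x := x :* con 1ℤ) refl x ⟩
    x * 1#         ≡⟨ cong (x *_) y²≡1 ⟨
    x * (y * y)    ≡⟨ solve 2 (λ x y → x :* (y :* y) := x :* y :* y) refl x y ⟩
    x * y * y      ≡⟨ cong (_* y) xy≡-1 ⟩
    - 1# * y       ≡⟨ solve 1 (λ y → :- con 1ℤ :* y := :- y) refl y ⟩
    - y            ∎

  G≈square⇒shape : ∀ {s t h₀ h₁ h₂} → 1# + 1# ≢ 0# → t ≢ 0# →
    G s t ≈ₚ ((h₀ ∷ h₁ ∷ h₂ ∷ []) *ₚ (h₀ ∷ h₁ ∷ h₂ ∷ [])) → h₀ ≡ h₂ × h₁ ≡ - h₂ × s ≡ - three × t ≡ 1#
  G≈square⇒shape {s} {t} {h₀} {h₁} {h₂} 2≢0 t≢0 G≈H² = h₀≡h₂ , h₁≡-h₂ , s≡-3 , t≡1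
    where
    two : Carrier
    two = 1# + 1#
    coefficient : ∀ i → coeff (G s t) i ≡
      coeff (h₀ * h₀ ∷ two * (h₀ * h₁) ∷ two * (h₀ * h₂) + h₁ * h₁ ∷ two * (h₁ * h₂) ∷ h₂ * h₂ ∷ []) i
    coefficient i = trans (G≈H² i) (quadratic-square h₀ h₁ h₂ i)
    h₂²≡1 : h₂ * h₂ ≡ 1#
    h₂²≡1 = sym (coefficient 4)
    h₁h₂≡-1 : h₁ * h₂ ≡ - 1#
    h₁h₂≡-1 = *-cancelˡ 2≢0 (trans (sym (coefficient 3)) (solve 0 (:- (con 1ℤ :+ con 1ℤ) := (con 1ℤ :+ con 1ℤ) :* :- con 1ℤ) refl))
    h₀h₁≡-t : h₀ * h₁ ≡ - t
    h₀h₁≡-t = *-cancelˡ 2≢0 (trans (sym (coefficient 1)) (solve 1 (λ t → :- ((con 1ℤ :+ con 1ℤ) :* t) := (con 1ℤ :+ con 1ℤ) :* :- t) refl t))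
    h₁≡-h₂ : h₁ ≡ - h₂
    h₁≡-h₂ = y²≡1⇒xy≡-1⇒x≡-y h₂²≡1 h₁h₂≡-1
    t≡h₀h₂ : t ≡ h₀ * h₂
    t≡h₀h₂ = begin
      t                   ≡⟨ solve 1 (λ t → t := :- (:- t)) refl t ⟩
      - (- t)             ≡⟨ cong -_ (sym h₀h₁≡-t) ⟩
      - (h₀ * h₁)         ≡⟨ cong (λ z → - (h₀ * z)) h₁≡-h₂ ⟩
      - (h₀ * - h₂)       ≡⟨ solve 2 (λ h₀ h₂ → :- (h₀ :* :- h₂) := h₀ :* h₂) refl h₀ h₂ ⟩
      h₀ * h₂             ∎
    h₀≢0 : h₀ ≢ 0#
    h₀≢0 h₀≡0 = t≢0 (trans t≡h₀h₂ (trans (cong (_* h₂) h₀≡0) (R.zeroˡ h₂)))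
    h₀≡h₂ : h₀ ≡ h₂
    h₀≡h₂ = *-cancelˡ h₀≢0 (trans (sym (coefficient 0)) t≡h₀h₂)
    t≡1 : t ≡ 1#
    t≡1 = trans t≡h₀h₂ (trans (cong (_* h₂) h₀≡h₂) h₂²≡1)
    s≡-3 : s ≡ - three
    s≡-3 = begin
      s                                          ≡⟨ solve 1 (λ s → s := :- (:- s)) refl s ⟩
      - (- s)                                    ≡⟨ cong -_ (coefficient 2) ⟩
      - (two * (h₀ * h₂) + h₁ * h₁)              ≡⟨ cong₂ (λ a b → - (two * (a * h₂) + b * b)) h₀≡h₂ h₁≡-h₂ ⟩
      - (two * (h₂ * h₂) + - h₂ * - h₂)
        ≡⟨ solve 1 (λ h₂ → :- ((con 1ℤ :+ con 1ℤ) :* (h₂ :* h₂) :+ :- h₂ :* :- h₂)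
                        := :- ((con 1ℤ :+ con 1ℤ :+ con 1ℤ) :* (h₂ :* h₂))) refl h₂ ⟩
      - (three * (h₂ * h₂))                      ≡⟨ cong (λ z → - (three * z)) h₂²≡1 ⟩
      - (three * 1#)                             ≡⟨ cong -_ (R.*-identityʳ three) ⟩
      - three                                    ∎

  G≈H²⇒H≈cΦ₆ : ∀ {s t H} → 1# + 1# ≢ 0# → t ≢ 0# → IsQuadratic H → G s t ≈ₚ (H *ₚ H) →
    ∃ (λ c → c ≢ 0# × H ≈ₚ scale c Φ₆) × s ≡ - three × t ≡ 1#
  G≈H²⇒H≈cΦ₆ {s} {t} {H} 2≢0 t≢0 H-quadratic G≈H² = (coeff H 2 , proj₁ H-quadratic , H≈cΦ₆) , s≡-3 , t≡1
    where
    H′ : Poly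
    H′ = coeff H 0 ∷ coeff H 1 ∷ coeff H 2 ∷ []
    H≈H′ : H ≈ₚ H′
    H≈H′ = degreeAtMost⇒≈ₚ-applyUpTo H (HasDegree.degree≤ (quadratic⇒degree2 H H-quadratic))
    G≈H′² : G s t ≈ₚ (H′ *ₚ H′)
    G≈H′² i = trans (G≈H² i) (*ₚ-cong {H} {H′} {H} {H′} H≈H′ H≈H′ i)
    shape : coeff H 0 ≡ coeff H 2 × coeff H 1 ≡ - coeff H 2 × s ≡ - three × t ≡ 1#
    shape = G≈square⇒shape 2≢0 t≢0 G≈H′²
    s≡-3 : s ≡ - three
    s≡-3 = proj₁ (proj₂ (proj₂ shape))
    t≡1 : t ≡ 1#
    t≡1 = proj₂ (proj₂ (proj₂ shape))
    H≈cΦ₆ : H ≈ₚ scale (coeff H 2) Φ₆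
    H≈cΦ₆ zero = trans (proj₁ shape) (sym (R.*-identityʳ _))
    H≈cΦ₆ (suc zero) = trans (proj₁ (proj₂ shape)) (solve 1 (λ c → :- c := c :* :- con 1ℤ) refl (coeff H 2))
    H≈cΦ₆ (suc (suc zero)) = sym (R.*-identityʳ _)
    H≈cΦ₆ (suc (suc (suc i))) = proj₂ H-quadratic i

  nondegenerate⇒t≢0 : ∀ {s t} → t * (1# + s + t) ≢ 0# → t ≢ 0#
  nondegenerate⇒t≢0 {s} {t} nondegenerate t≡0 = nondegenerate (trans (cong (_* (1# + s + t)) t≡0) (R.zeroˡ _))

  classIIIc⇒equivalent-f₋₃,₁ : 1# + 1# ≢ 0# → ∀ g → ClassIIIc g → Equivalent g (f (- three) 1#)
  classIIIc⇒equivalent-f₋₃,₁ 2≢0 g (s , t , nondegenerate , (H , H-quadratic , _ , G≈H²) , g~fₛₜ) =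
    subst₂ (λ s t → Equivalent g (f s t)) (proj₁ s,t≡-3,1) (proj₂ s,t≡-3,1) g~fₛₜ
    where
    s,t≡-3,1 : s ≡ - three × t ≡ 1#
    s,t≡-3,1 = proj₂ (G≈H²⇒H≈cΦ₆ {s} {t} {H} 2≢0 (nondegenerate⇒t≢0 nondegenerate) H-quadratic G≈H²)

  classIIIc⇒no-primitiveCubeRoot : 1# + 1# ≢ 0# → ∀ g → ClassIIIc g → ∀ ω → ¬ PrimitiveCubeRoot ω
  classIIIc⇒no-primitiveCubeRoot 2≢0 _ (s , t , nondegenerate , (H , H-quadratic , H-irreducible , G≈H²) , _) ω root =
    let (c , c≢0 , H≈cΦ₆) , _ = G≈H²⇒H≈cΦ₆ {s} {t} {H} 2≢0 (nondegenerate⇒t≢0 nondegenerate) H-quadratic G≈H²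
    in scaled-Φ₆-reducible {H = H} c≢0 root H≈cΦ₆ H-irreducible

  f₋₃,₁∈classIIIc : (∀ ω → ¬ PrimitiveCubeRoot ω) → ClassIIIc (f (- three) 1#)
  f₋₃,₁∈classIIIc no-root =
    - three , 1# , nondegenerate , (Φ₆ , Φ₆-quadratic , Φ₆-irreducible no-root , G₋₃,₁≈Φ₆²) , f-equivalent-to-itself (- three) 1#
    where
    nondegenerate : 1# * (1# + - three + 1#) ≢ 0#
    nondegenerate degenerate = 1≢0 (begin
      1#                                  ≡⟨ solve 0 (con 1ℤ := :- (con 1ℤ :* (con 1ℤ :+ :- (con 1ℤ :+ con 1ℤ :+ con 1ℤ) :+ con 1ℤ))) refl ⟩
      - (1# * (1# + - three + 1#))        ≡⟨ cong -_ degenerate ⟩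
      - 0#                                ≡⟨ solve 0 (:- con 0ℤ := con 0ℤ) refl ⟩
      0#                                  ∎)

corollary6p20 : (p k q : ℕ) → Prime p → 5 ≤ p → 1 ≤ k → q ≡ p ^ k → (F : FiniteField q) →
    let open FiniteField F
        open RatFun F
    in (q % 6 ≡ 1 → ∀ (g : RatFunc) → ¬ ClassIIIc g)
       × (¬ (q % 6 ≡ 1) →
            ClassIIIc (f (- three) 1#)
            × (∀ (g : RatFunc) → ClassIIIc g → Equivalent g (f (- three) 1#)))
corollary6p20 p k .(p ^ k) p-prime 5≤p _ refl F = class-empty , class-single
  where
  open FiniteField F
  open RatFun F using (RatFunc; ClassIIIc; Equivalent; f; three)
  open FiniteFieldProperties F
  open Classification F

  2∤q : ¬ 2 ∣ p ^ k
  2∤q = prime∤prime^ prime[2] p-prime (ℕ.<-≤-trans (s≤s (s≤s (s≤s z≤n))) 5≤p) k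

  3∤q : ¬ 3 ∣ p ^ k
  3∤q = prime∤prime^ (from-yes (prime? 3)) p-prime (ℕ.<-≤-trans (s≤s (s≤s (s≤s (s≤s z≤n)))) 5≤p) k

  class-empty : p ^ k % 6 ≡ 1 → ∀ (g : RatFunc) → ¬ ClassIIIc g
  class-empty q%6≡1 g g∈IIIc =
    let ω , root = primitiveCubeRoot-exists q%6≡1 in classIIIc⇒no-primitiveCubeRoot (1+1≢0 2∤q) g g∈IIIc ω root

  class-single : ¬ (p ^ k % 6 ≡ 1) →
    ClassIIIc (f (- three) 1#) × (∀ (g : RatFunc) → ClassIIIc g → Equivalent g (f (- three) 1#))
  class-single q%6≢1 = f₋₃,₁∈classIIIc no-root , classIIIc⇒equivalent-f₋₃,₁ (1+1≢0 2∤q)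
    where
    no-root : ∀ ω → ¬ PrimitiveCubeRoot ω
    no-root _ root = q%6≢1 (primitiveCubeRoot⇒q%6≡1 2∤q 3∤q root)
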